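{- Let $n\ge 2$ and $k,n\in\mathbb{N}$. The path $P_n$ on $n$ vertices is $k$-distance magic if and only if $k=1$ and $n=3$.
   Context: All graphs are finite, simple and undirected; $d(u,v)$ is graph distance. For $u\in V(G)$ and $k\in\mathbb{N}$, $\partial N_k(u)=\{v\in V(G): d(u,v)=k\}$. For a graph $G$ of order $n\ge3$, a $k$-distance magic labeling ($k$-DML) is a bijection $f:V(G)\to\{1,\dots,n\}$ together with a constant $M$ such that $\sum_{w\in\partial N_k(u)} f(w)=M$ for every vertex $u$ with $\partial N_k(u)\neq\emptyset$; moreover $G$ is required to contain at least one pair of vertices at distance $k$. $G$ is $k$-distance magic ($k$-DM) if it has a $k$-DML. -}

module Defs where

open import Level using (0ℓ)
open import Data.Nat using (ℕ; zero; suc; _+_; _≤_; _<_)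
open import Data.Fin using (Fin; toℕ)
open import Data.List using (List; []; _∷_; map)
open import Data.Nat.ListAction using (sum)
open import Data.List.Membership.Propositional using (_∈_)
open import Data.List.Relation.Unary.Unique.Propositional using (Unique)
open import Data.Product using (Σ; ∃; _×_; _,_)
open import Data.Sum using (_⊎_)
open import Relation.Nullary using (¬_)
open import Relation.Binary.PropositionalEquality using (_≡_)
import Relation.Binary.PropositionalEquality
open import Function.Definitions using (Bijective)
open import Function.Bundles using (_⇔_)

record Graph (n : ℕ) : Set₁ where
  field
    Adj     : Fin n → Fin n → Set
    sym     : ∀ {u v} → Adj u v → Adj v u
    irrefl  : ∀ {u} → ¬ Adj u u

open Graph public

data Walk {n : ℕ} (G : Graph n) : Fin n → Fin n → ℕ → Set where
  here : ∀ {u} → Walk G u u zero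
  step : ∀ {u v w ℓ} → Adj G u v → Walk G v w ℓ → Walk G u w (suc ℓ)

Dist : ∀ {n} → Graph n → Fin n → Fin n → ℕ → Set
Dist G u v k = Walk G u v k × (∀ m → m < k → ¬ Walk G u v m)

pathAdj : ∀ {n} → Fin n → Fin n → Set
pathAdj i j = (toℕ j ≡ suc (toℕ i)) ⊎ (toℕ i ≡ suc (toℕ j))

pathGraph : (n : ℕ) → Graph n
pathGraph n = record { Adj = pathAdj ; sym = s ; irrefl = ir }
  where
  open import Data.Sum using (inj₁; inj₂)
  open import Data.Nat.Properties using (n<1+n; <-irrefl)
  s : ∀ {u v} → pathAdj u v → pathAdj v u
  s (inj₁ p) = inj₂ p
  s (inj₂ p) = inj₁ p
  ir : ∀ {u} → ¬ pathAdj u u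
  ir (inj₁ p) = <-irrefl p (n<1+n _)
  ir (inj₂ p) = <-irrefl p (n<1+n _)

IsSphere : ∀ {n} → Graph n → ℕ → Fin n → List (Fin n) → Set
IsSphere G k u S = Unique S × (∀ w → (w ∈ S) ⇔ Dist G u w k)

-- f : V → {1,…,n} is represented by a bijection f : Fin n → Fin n,
-- the label of v being toℕ (f v) + 1.
label : ∀ {n} → (Fin n → Fin n) → Fin n → ℕ
label f v = suc (toℕ (f v))

IsKDML : ∀ {n} → Graph n → ℕ → (Fin n → Fin n) → ℕ → Set
IsKDML {n} G k f M =
  Bijective _≡_ _≡_ f ×
  (∀ u (S : List (Fin n)) → IsSphere G k u S → ¬ (S ≡ []) →
     sum (map (label f) S) ≡ M)

IsKDM : ∀ {n} → Graph n → ℕ → Set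
IsKDM {n} G k =
  3 ≤ n ×
  (Σ (Fin n) λ u → Σ (Fin n) λ v → Dist G u v k) ×
  (Σ (Fin n → Fin n) λ f → Σ ℕ λ M → IsKDML G k f M)

-- In P_n the k-sphere of an endpoint, and of the vertex 1 when k ≥ 2, is a
-- single vertex, which a magic labeling must therefore label with the magic
-- constant M; by injectivity all such vertices coincide. The endpoints 0 and
-- n − 1 give k = n − 1 − k, so k ≠ 0 as n ≥ 3; the vertices 0 and 1 give
-- k = k + 1 when k ≥ 2. Hence k = 1 and n = 3, and conversely labeling P_3 by
-- 1, 3, 2 is 1-distance magic with M = 3.
module Submission where

open import Defs hiding (sym)
open import Data.Nat using (ℕ; zero; suc; _+_; _∸_; _≤_; _<_; ∣_-_∣; z≤n; s≤s; z<s)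
open import Data.Nat.Properties
open import Data.Nat.ListAction using (sum)
open import Data.Nat.ListAction.Properties using (sum-↭)
open import Data.Fin using (Fin; toℕ; fromℕ<)
open import Data.Fin.Patterns using (0F; 1F; 2F)
open import Data.Fin.Properties using (toℕ-injective; toℕ<n; toℕ-fromℕ<)
open import Data.Fin.Permutation using (Permutation′; transpose; _⟨$⟩ʳ_)
open import Data.List using (List; []; _∷_; [_]; map)
open import Data.List.Membership.Propositional using (_∈_)
open import Data.List.Membership.Propositional.Properties.WithK using (unique∧set⇒bag)
open import Data.List.Relation.Unary.Any using (here; there)
open import Data.List.Relation.Unary.All using ([]; _∷_)
open import Data.List.Relation.Unary.AllPairs using ([]; _∷_)
open import Data.List.Relation.Unary.Unique.Propositional using (Unique)
open import Data.List.Relation.Binary.BagAndSetEquality using (∼bag⇒↭)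
open import Data.List.Relation.Binary.Permutation.Propositional.Properties using (map⁺)
open import Data.Product using (_×_; _,_; proj₁)
open import Data.Sum using (inj₁; inj₂)
open import Function.Bundles using (_⇔_; mk⇔; Equivalence; Bijection)
open import Function.Definitions using (Bijective)
open import Function.Properties.Inverse using (Inverse⇒Bijection)
open import Function.Construct.Composition using (_⇔-∘_)
open import Function.Construct.Symmetry using (⇔-sym)
open import Relation.Binary.PropositionalEquality
  using (_≡_; refl; sym; trans; cong; cong₂; subst; module ≡-Reasoning)

private
  variable
    n N k m M : ℕ

sum-map-unique-set : ∀ {A : Set} (g : A → ℕ) {xs ys : List A} → Unique xs → Unique ys →
                     (∀ x → x ∈ xs ⇔ x ∈ ys) → sum (map g xs) ≡ sum (map g ys)
sum-map-unique-set g uxs uys xs≈ys =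
  sum-↭ (map⁺ g (∼bag⇒↭ (unique∧set⇒bag uxs uys (λ {x} → xs≈ys x))))

module _ {G : Graph n} where

  walk-snoc : ∀ {u v w} → Walk G u v m → Adj G v w → Walk G u w (suc m)
  walk-snoc here        vw = step vw here
  walk-snoc (step uv p) vw = step uv (walk-snoc p vw)

  walk-reverse : ∀ {u v} → Walk G u v m → Walk G v u m
  walk-reverse here        = here
  walk-reverse (step uv p) = walk-snoc (walk-reverse p) (Graph.sym G uv)

  sphere-sum-irrelevant : ∀ (g : Fin n → ℕ) {u S T} → IsSphere G k u S → IsSphere G k u T →
                          sum (map g S) ≡ sum (map g T)
  sphere-sum-irrelevant g (uS , S≈) (uT , T≈) =
    sum-map-unique-set g uS uT λ w → ⇔-sym (T≈ w) ⇔-∘ S≈ w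

  magic-singleton-sphere : ∀ {f u t} → IsKDML G k f M → Dist G u t k →
                           (∀ w → Dist G u w k → w ≡ t) → label f t ≡ M
  magic-singleton-sphere {t = t} (_ , magic) ut unique =
    trans (sym (+-identityʳ _)) (magic _ [ t ] sphere λ ())
    where
    sphere : IsSphere G _ _ [ t ]
    sphere = ([] ∷ []) , λ w → mk⇔ (λ { (here refl) → ut }) (λ uw → here (unique w uw))

label-injective : ∀ {f : Fin n → Fin n} {a b} → Bijective _≡_ _≡_ f → label f a ≡ label f b → a ≡ b
label-injective (f-injective , _) eq = f-injective (toℕ-injective (suc-injective eq))

∣m-1+m∣≡1 : ∀ m → ∣ m - suc m ∣ ≡ 1
∣m-1+m∣≡1 zero    = refl
∣m-1+m∣≡1 (suc m) = ∣m-1+m∣≡1 m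

pathAdj⇒∣-∣≡1 : ∀ {u v : Fin n} → pathAdj u v → ∣ toℕ u - toℕ v ∣ ≡ 1
pathAdj⇒∣-∣≡1 {u = u} (inj₁ v≡1+u) =
  trans (cong (λ x → ∣ toℕ u - x ∣) v≡1+u) (∣m-1+m∣≡1 (toℕ u))
pathAdj⇒∣-∣≡1 {u = u} {v} (inj₂ u≡1+v) =
  trans (cong (λ x → ∣ x - toℕ v ∣) u≡1+v) (trans (∣-∣-comm (suc (toℕ v)) (toℕ v)) (∣m-1+m∣≡1 (toℕ v)))

path-walk-length-≥ : ∀ {u v : Fin n} {m} → Walk (pathGraph n) u v m → ∣ toℕ u - toℕ v ∣ ≤ m
path-walk-length-≥ {u = u} here = ≤-reflexive (∣n-n∣≡0 (toℕ u))
path-walk-length-≥ {u = u} {v} {suc m} (step {v = w} uw p) = begin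
  ∣ toℕ u - toℕ v ∣                     ≤⟨ ∣-∣-triangle (toℕ u) (toℕ w) (toℕ v) ⟩
  ∣ toℕ u - toℕ w ∣ + ∣ toℕ w - toℕ v ∣ ≡⟨ cong (_+ ∣ toℕ w - toℕ v ∣) (pathAdj⇒∣-∣≡1 uw) ⟩
  suc ∣ toℕ w - toℕ v ∣                 ≤⟨ s≤s (path-walk-length-≥ p) ⟩
  suc m                                 ∎
  where open ≤-Reasoning

path-ascending-walk : ∀ m {u v : Fin n} → toℕ v ≡ toℕ u + m → Walk (pathGraph n) u v m
path-ascending-walk zero {u} e =
  subst (λ v → Walk (pathGraph _) u v 0) (toℕ-injective (sym (trans e (+-identityʳ _)))) here
path-ascending-walk {n} (suc m) {u} {v} e =
  step (inj₁ (toℕ-fromℕ< 1+u<n))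
       (path-ascending-walk m (trans v≡2+u+m (cong (_+ m) (sym (toℕ-fromℕ< 1+u<n)))))
  where
  v≡2+u+m : toℕ v ≡ suc (toℕ u + m)
  v≡2+u+m = trans e (+-suc (toℕ u) m)
  1+u<n : suc (toℕ u) < n
  1+u<n = ≤-<-trans (s≤s (m≤m+n (toℕ u) m)) (subst (_< n) v≡2+u+m (toℕ<n v))

path-ascending-geodesic : ∀ {u v : Fin n} → toℕ u ≤ toℕ v → Walk (pathGraph n) u v ∣ toℕ u - toℕ v ∣
path-ascending-geodesic u≤v =
  subst (Walk _ _ _) (sym (m≤n⇒∣m-n∣≡n∸m u≤v)) (path-ascending-walk _ (sym (m+[n∸m]≡n u≤v)))

path-geodesic : ∀ (u v : Fin n) → Walk (pathGraph n) u v ∣ toℕ u - toℕ v ∣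
path-geodesic u v with ≤-total (toℕ u) (toℕ v)
... | inj₁ u≤v = path-ascending-geodesic u≤v
... | inj₂ v≤u =
  subst (Walk _ u v) (∣-∣-comm (toℕ v) (toℕ u)) (walk-reverse (path-ascending-geodesic v≤u))

path-dist⇔∣-∣ : ∀ {u v : Fin n} → Dist (pathGraph n) u v k ⇔ ∣ toℕ u - toℕ v ∣ ≡ k
path-dist⇔∣-∣ {u = u} {v} = mk⇔ to from
  where
  to : Dist (pathGraph _) u v _ → ∣ toℕ u - toℕ v ∣ ≡ _
  to (walk , shortest) =
    ≤-antisym (path-walk-length-≥ walk) (≮⇒≥ λ shorter → shortest _ shorter (path-geodesic u v))
  from : ∣ toℕ u - toℕ v ∣ ≡ _ → Dist (pathGraph _) u v _
  from refl = path-geodesic u v , λ _ m<k walk → <⇒≱ m<k (path-walk-length-≥ walk)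

∣-∣<n : ∀ (u v : Fin n) → ∣ toℕ u - toℕ v ∣ < n
∣-∣<n u v = ≤-<-trans (∣m-n∣≤m⊔n (toℕ u) (toℕ v)) (⊔-lub (toℕ<n u) (toℕ<n v))

∣m-n∣≡o⇒n≡m∸o : ∀ {m n o} → n ≤ m → ∣ m - n ∣ ≡ o → n ≡ m ∸ o
∣m-n∣≡o⇒n≡m∸o {m} n≤m e =
  trans (sym (m∸[m∸n]≡n n≤m)) (cong (m ∸_) (trans (sym (m≤n⇒∣n-m∣≡n∸m n≤m)) e))

∣1-m∣≡o⇒m≡1+o : ∀ {o} → 1 < o → ∀ m → ∣ 1 - m ∣ ≡ o → m ≡ suc o
∣1-m∣≡o⇒m≡1+o (s≤s ()) zero refl
∣1-m∣≡o⇒m≡1+o _ (suc m) e = cong suc e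

module PathMagic {f : Fin (suc N) → Fin (suc N)}
                 (magic : IsKDML (pathGraph (suc N)) k f M) (k≤N : k ≤ N) where

  sole-at-distance⇒label≡M : ∀ {i j} (i<n : i < suc N) (j<n : j < suc N) → ∣ i - j ∣ ≡ k →
                             (∀ w → ∣ i - toℕ w ∣ ≡ k → toℕ w ≡ j) → label f (fromℕ< j<n) ≡ M
  sole-at-distance⇒label≡M {i} {j} i<n j<n ij≡k unique =
    magic-singleton-sphere magic (Equivalence.from path-dist⇔∣-∣ (trans toℕ-ij ij≡k)) unique-vertex
    where
    toℕ-ij : ∣ toℕ (fromℕ< i<n) - toℕ (fromℕ< j<n) ∣ ≡ ∣ i - j ∣
    toℕ-ij = cong₂ ∣_-_∣ (toℕ-fromℕ< i<n) (toℕ-fromℕ< j<n)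
    unique-vertex : ∀ w → Dist (pathGraph (suc N)) (fromℕ< i<n) w k → w ≡ fromℕ< j<n
    unique-vertex w iw = toℕ-injective (trans (unique w iw≡k) (sym (toℕ-fromℕ< j<n)))
      where
      iw≡k : ∣ i - toℕ w ∣ ≡ k
      iw≡k = trans (cong (λ x → ∣ x - toℕ w ∣) (sym (toℕ-fromℕ< i<n))) (Equivalence.to path-dist⇔∣-∣ iw)

  label≡M-unique : ∀ {i j} (i<n : i < suc N) (j<n : j < suc N) →
                          label f (fromℕ< i<n) ≡ M → label f (fromℕ< j<n) ≡ M → i ≡ j
  label≡M-unique {i} {j} i<n j<n i-magic j-magic = begin
    i                    ≡⟨ toℕ-fromℕ< i<n ⟨
    toℕ (fromℕ< i<n)     ≡⟨ cong toℕ (label-injective (proj₁ magic) (trans i-magic (sym j-magic))) ⟩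
    toℕ (fromℕ< j<n)     ≡⟨ toℕ-fromℕ< j<n ⟩
    j                    ∎
    where open ≡-Reasoning

  k<n : k < suc N
  k<n = s≤s k≤N

  label-k≡M : label f (fromℕ< k<n) ≡ M
  label-k≡M = sole-at-distance⇒label≡M z<s k<n refl λ _ e → e

  k+k≡N : k + k ≡ N
  k+k≡N = begin
    k + k        ≡⟨ cong (k +_) (label≡M-unique k<n N∸k<n label-k≡M label-N∸k≡M) ⟩
    k + (N ∸ k)  ≡⟨ m+[n∸m]≡n k≤N ⟩
    N            ∎
    where
    open ≡-Reasoning
    N∸k<n : N ∸ k < suc N
    N∸k<n = s≤s (m∸n≤m N k)
    label-N∸k≡M : label f (fromℕ< N∸k<n) ≡ M
    label-N∸k≡M =
      sole-at-distance⇒label≡M ≤-refl N∸k<n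
        (trans (m≤n⇒∣n-m∣≡n∸m (m∸n≤m N k)) (m∸[m∸n]≡n k≤N))
        (λ w e → ∣m-n∣≡o⇒n≡m∸o (≤-pred (toℕ<n w)) e)

  k≤1 : k ≤ 1
  k≤1 = ≮⇒≥ λ 1<k →
    1+n≢n (sym (label≡M-unique k<n (1+k<n 1<k) label-k≡M (label-1+k≡M 1<k)))
    where
    1+k<n : 1 < k → suc k < suc N
    1+k<n 1<k = s≤s (≤-trans (+-monoˡ-≤ k (<⇒≤ 1<k)) (≤-reflexive k+k≡N))
    label-1+k≡M : (1<k : 1 < k) → label f (fromℕ< (1+k<n 1<k)) ≡ M
    label-1+k≡M 1<k =
      sole-at-distance⇒label≡M (s≤s (≤-trans (<⇒≤ 1<k) k≤N)) (1+k<n 1<k) refl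
        (λ w → ∣1-m∣≡o⇒m≡1+o 1<k (toℕ w))

k≡1∧1+N≡3 : k + k ≡ N → k ≤ 1 → 2 ≤ N → k ≡ 1 × suc N ≡ 3
k≡1∧1+N≡3 refl z≤n       ()
k≡1∧1+N≡3 refl (s≤s z≤n) _  = refl , refl

path-IsKDM⇒k≡1∧n≡3 : IsKDM (pathGraph n) k → k ≡ 1 × n ≡ 3
path-IsKDM⇒k≡1∧n≡3 {suc N} (s≤s 2≤N , (u , v , uv) , f , M , magic) = k≡1∧1+N≡3 k+k≡N k≤1 2≤N
  where
  k≤N : _ ≤ N
  k≤N = ≤-pred (subst (_< suc N) (Equivalence.to path-dist⇔∣-∣ uv) (∣-∣<n u v))
  open PathMagic magic k≤N

swap₁₂ : Permutation′ 3
swap₁₂ = transpose 1F 2F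

P₃-unit-sphere : Fin 3 → List (Fin 3)
P₃-unit-sphere 0F = [ 1F ]
P₃-unit-sphere 1F = 0F ∷ 2F ∷ []
P₃-unit-sphere 2F = [ 1F ]

P₃-unit-sphere-unique : ∀ u → Unique (P₃-unit-sphere u)
P₃-unit-sphere-unique 0F = [] ∷ []
P₃-unit-sphere-unique 1F = ((λ ()) ∷ []) ∷ [] ∷ []
P₃-unit-sphere-unique 2F = [] ∷ []

∈-P₃-unit-sphere⇔ : ∀ u w → w ∈ P₃-unit-sphere u ⇔ ∣ toℕ u - toℕ w ∣ ≡ 1
∈-P₃-unit-sphere⇔ u w = mk⇔ (to u w) (from u w)
  where
  to : ∀ u w → w ∈ P₃-unit-sphere u → ∣ toℕ u - toℕ w ∣ ≡ 1
  to 0F _ (here refl)         = refl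
  to 1F _ (here refl)         = refl
  to 1F _ (there (here refl)) = refl
  to 2F _ (here refl)         = refl
  from : ∀ u w → ∣ toℕ u - toℕ w ∣ ≡ 1 → w ∈ P₃-unit-sphere u
  from 0F 1F _ = here refl
  from 1F 0F _ = here refl
  from 1F 2F _ = there (here refl)
  from 2F 1F _ = here refl
  from 0F 0F ()
  from 0F 2F ()
  from 1F 1F ()
  from 2F 0F ()
  from 2F 2F ()

P₃-unit-sphere-isSphere : ∀ u → IsSphere (pathGraph 3) 1 u (P₃-unit-sphere u)
P₃-unit-sphere-isSphere u =
  P₃-unit-sphere-unique u , λ w → ⇔-sym path-dist⇔∣-∣ ⇔-∘ ∈-P₃-unit-sphere⇔ u w

P₃-IsKDML-1 : IsKDML (pathGraph 3) 1 (swap₁₂ ⟨$⟩ʳ_) 3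
P₃-IsKDML-1 = Bijection.bijective (Inverse⇒Bijection swap₁₂) , λ u S S-sphere _ →
  trans (sphere-sum-irrelevant (label _) S-sphere (P₃-unit-sphere-isSphere u)) (unit-sphere-sum u)
  where
  unit-sphere-sum : ∀ u → sum (map (label (swap₁₂ ⟨$⟩ʳ_)) (P₃-unit-sphere u)) ≡ 3
  unit-sphere-sum 0F = refl
  unit-sphere-sum 1F = refl
  unit-sphere-sum 2F = refl

P₃-IsKDM-1 : IsKDM (pathGraph 3) 1
P₃-IsKDM-1 = s≤s (s≤s (s≤s z≤n)) , (0F , 1F , Equivalence.from path-dist⇔∣-∣ refl) , _ , 3 , P₃-IsKDML-1

-- The hypothesis 2 ≤ n is unused: IsKDM already requires order at least 3.
theorem2p1 : (n k : ℕ) → 2 ≤ n → (IsKDM (pathGraph n) k ⇔ (k ≡ 1 × n ≡ 3))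
theorem2p1 n k _ = mk⇔ path-IsKDM⇒k≡1∧n≡3 λ { (refl , refl) → P₃-IsKDM-1 }
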